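{- There is an absolute constant $c$ such that for all positive integers $n,k$ and every $k$-monotone sequence $S\in[n]^n$, $LF^k(S)\le c\,nk$.
   Context: A sequence $S=(s_1,\dots,s_m)$ contains a permutation $\pi$ of $[r]$ if there are indices $i_1<\dots<i_r$ with $s_{i_a}<s_{i_b}$ iff $\pi(a)<\pi(b)$; otherwise it avoids $\pi$. $S$ is $k$-monotone if it avoids $(1,2,\dots,k)$ or avoids $(k,k-1,\dots,1)$ (equivalently $k\ge m(S)$, the smallest integer $r$ such that $S$ avoids $(1,\dots,r)$ or $(r,\dots,1)$). For a BST $T$ on $[n]$, $d_T(x,y)$ is the number of edges on the $x$–$y$ path. A finger strategy $(\vec f,\vec\ell)$ with $\vec f\in[k]^m$, $\vec\ell\in[n]^k$: finger $i$ starts at $\ell_i$; at time $t$ finger $f_t$ moves from its location $\sigma(f_t,t)$ to $s_t$; cost $\sum_t(1+d_T(s_t,\sigma(f_t,t)))$. $LF^k_T(S)$ is the minimum over strategies and $LF^k(S)=\min_T LF^k_T(S)$ over BSTs $T$ on $[n]$. -}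

module Defs where

open import Data.Nat using (ℕ; zero; suc; _+_; _*_; _∸_; _≤_; _<_; _<ᵇ_; _≡ᵇ_)
open import Data.Bool using (Bool; true; false; if_then_else_)
open import Data.Fin as Fin using (Fin; toℕ; opposite)
open import Data.Fin.Properties using (_≟_)
open import Data.List using (List; []; _∷_; _++_; upTo)
open import Data.Vec using (Vec; []; _∷_; tabulate)
open import Data.Product using (Σ; ∃; ∃-syntax; _×_; _,_)
open import Data.Sum using (_⊎_)
open import Function using (id)
open import Function.Bundles using (_⇔_)
open import Relation.Nullary using (¬_; yes; no)
open import Relation.Binary.PropositionalEquality using (_≡_)

Contains : ∀ {m r} → (Fin m → ℕ) → (Fin r → Fin r) → Set
Contains {m} {r} S π =
  Σ (Fin r → Fin m) λ ι →
    (∀ a b → a Fin.< b → ι a Fin.< ι b) ×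
    (∀ a b → (S (ι a) < S (ι b)) ⇔ (π a Fin.< π b))

Avoids : ∀ {m r} → (Fin m → ℕ) → (Fin r → Fin r) → Set
Avoids S π = ¬ Contains S π

idPerm : ∀ k → Fin k → Fin k
idPerm k = id

revPerm : ∀ k → Fin k → Fin k
revPerm k = opposite

KMonotone : ∀ {m} → ℕ → (Fin m → ℕ) → Set
KMonotone k S = Avoids S (idPerm k) ⊎ Avoids S (revPerm k)

data BT : Set where
  leaf : BT
  node : BT → ℕ → BT → BT

inorder : BT → List ℕ
inorder leaf = []
inorder (node l x r) = inorder l ++ (x ∷ inorder r)

-- T is a BST on [n] (shifted to keys 0..n-1): its in-order key sequence
-- is exactly 0,1,…,n-1.
IsBSTOn : ℕ → BT → Set
IsBSTOn n T = inorder T ≡ upTo n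

depth : BT → ℕ → ℕ
depth leaf x = 0
depth (node l k r) x =
  if x ≡ᵇ k then 0 else (if x <ᵇ k then suc (depth l x) else suc (depth r x))

-- d_T(x,y): number of edges on the x–y path in T: descend while both
-- keys lie in the same subtree; at the lowest common ancestor add depths.
dist : BT → ℕ → ℕ → ℕ
dist leaf x y = 0
dist T@(node l k r) x y =
  if (x <ᵇ k) ∧ (y <ᵇ k) then dist l x y
  else (if (k <ᵇ x) ∧ (k <ᵇ y) then dist r x y
        else depth T x + depth T y)
  where
  _∧_ : Bool → Bool → Bool
  true ∧ b = b
  false ∧ b = false

update : ∀ {k} → (Fin k → ℕ) → Fin k → ℕ → (Fin k → ℕ)
update σ f s i with i ≟ f
... | yes _ = s
... | no _ = σ i

serveCost : ∀ {k m} → BT → (Fin k → ℕ) → Vec (Fin k × ℕ) m → ℕ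
serveCost T σ [] = 0
serveCost T σ ((f , s) ∷ rest) =
  suc (dist T s (σ f)) + serveCost T (update σ f s) rest

strategyCost : ∀ {n k m} → BT → (Fin m → Fin n) →
               (Fin m → Fin k) → (Fin k → Fin n) → ℕ
strategyCost T S f ℓ =
  serveCost T (λ i → toℕ (ℓ i)) (tabulate (λ t → f t , toℕ (S t)))

-- LF^k_T(S) ≤ b: some strategy has cost ≤ b (LF^k_T is a min over a
-- finite nonempty set, so this is exactly "LF^k_T(S) ≤ b").
LF-T-≤ : ∀ {n m} → ℕ → BT → (Fin m → Fin n) → ℕ → Set
LF-T-≤ {n} {m} k T S b =
  Σ (Fin m → Fin k) λ f → Σ (Fin k → Fin n) λ ℓ → strategyCost T S f ℓ ≤ b

LF-≤ : ∀ {n m} → ℕ → (Fin m → Fin n) → ℕ → Set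
LF-≤ {n} k S b = Σ BT λ T → IsBSTOn n T × LF-T-≤ k T S b

-- Proof idea: lay the keys out on a path, a BST in which every left subtree is
-- empty, so that d_T(x,y) ≤ |x - y|. If S avoids (1,…,k), serve it greedily in the
-- manner of patience sorting: all k fingers start on the largest key, and each request
-- is served by the first finger lying at or above it. Patience sorting guarantees that
-- such a finger exists, so every finger only moves downwards, and the total movement
-- is bounded by the initial potential k(n-1). The cost is therefore at most
-- n + k(n-1) ≤ 2nk. If S avoids (k,…,1), run the same argument on the reflected
-- keys n-1-x, which are still contracted by the path.

module Submission where

open import Defs
open import Data.Nat using (ℕ; _*_; _≤_)
open import Data.Fin using (Fin; toℕ)
open import Data.Product using (Σ)

open import Data.Nat hiding (_≟_)
open import Data.Nat.Properties hiding (_≟_)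
open import Algebra.Properties.CommutativeSemigroup +-commutativeSemigroup using (xy∙z≈zy∙x; x∙yz≈y∙xz)
open import Data.Bool using (true; false; T)
open import Data.Bool.Properties using (T-≡)
open import Data.Fin as F using (zero; suc; fromℕ; inject₁; opposite)
open import Data.Fin.Properties using (_≟_; toℕ<n; toℕ-fromℕ; toℕ-inject₁; opposite-prop)
import Data.Fin.Properties as F
open import Data.List as List using (applyUpTo)
open import Data.Product using (_×_; _,_)
open import Data.Sum using (_⊎_; inj₁; inj₂; [_,_]′; map₂)
open import Data.Unit using (⊤)
open import Data.Vec using (Vec; []; _∷_; tabulate)
open import Data.Vec.Properties using (tabulate-cong)
open import Data.Vec.Functional using (foldr)
open import Function using (_∘_; const; _⇔_; mk⇔; Equivalence)
open import Level using (0ℓ)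
open import Relation.Binary using (Rel; _Preserves_⟶_; Irreflexive; Asymmetric; tri<; tri≈; tri>)
open import Relation.Binary.PropositionalEquality
open import Relation.Nullary using (¬_; yes; no; contradiction)

-- The path tree

applyUpTo-cong : ∀ {A : Set} {f g : ℕ → A} → f ≗ g → ∀ m → applyUpTo f m ≡ applyUpTo g m
applyUpTo-cong f≗g zero = refl
applyUpTo-cong f≗g (suc m) = cong₂ List._∷_ (f≗g 0) (applyUpTo-cong (f≗g ∘ suc) m)

path : ℕ → ℕ → BT
path a zero = leaf
path a (suc m) = node leaf a (path (suc a) m)

inorder-path : ∀ a m → inorder (path a m) ≡ applyUpTo (a +_) m
inorder-path a zero = refl
inorder-path a (suc m) = cong₂ List._∷_ (sym (+-identityʳ a)) (begin
  inorder (path (suc a) m)    ≡⟨ inorder-path (suc a) m ⟩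
  applyUpTo (suc a +_) m      ≡⟨ applyUpTo-cong (λ i → sym (+-suc a i)) m ⟩
  applyUpTo ((a +_) ∘ suc) m  ∎)
  where open ≡-Reasoning

path-isBST : ∀ n → IsBSTOn n (path 0 n)
path-isBST = inorder-path 0

<ᵇ-true : ∀ {m n} → m < n → (m <ᵇ n) ≡ true
<ᵇ-true = Equivalence.to T-≡ ∘ <⇒<ᵇ

¬T⇒≡false : ∀ {b} → ¬ T b → b ≡ false
¬T⇒≡false {false} _ = refl
¬T⇒≡false {true} ¬t = contradiction _ ¬t

<ᵇ-false : ∀ {m n} → n ≤ m → (m <ᵇ n) ≡ false
<ᵇ-false {m} {n} n≤m = ¬T⇒≡false (≤⇒≯ n≤m ∘ <ᵇ⇒< m n)

≡ᵇ-refl : ∀ n → (n ≡ᵇ n) ≡ true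
≡ᵇ-refl n = Equivalence.to T-≡ (≡⇒≡ᵇ n n refl)

≡ᵇ-false : ∀ {m n} → m ≢ n → (m ≡ᵇ n) ≡ false
≡ᵇ-false {m} {n} m≢n = ¬T⇒≡false (m≢n ∘ ≡ᵇ⇒≡ m n)

depth-path : ∀ {a y} m → a ≤ y → depth (path a m) y ≤ y ∸ a
depth-path zero a≤y = z≤n
depth-path {a} {y} (suc m) a≤y with m≤n⇒m<n∨m≡n a≤y
... | inj₂ refl rewrite ≡ᵇ-refl a = z≤n
... | inj₁ a<y rewrite ≡ᵇ-false (>⇒≢ a<y) | <ᵇ-false a≤y =
  ≤-trans (s≤s (depth-path m a<y)) (≤-reflexive (sym (+-∸-assoc 1 a<y)))

dist-path : ∀ {a x y} m → a ≤ x → a ≤ y → dist (path a m) x y ≤ ∣ x - y ∣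
dist-path zero a≤x a≤y = z≤n
dist-path {a} {x} {y} (suc m) a≤x a≤y with m≤n⇒m<n∨m≡n a≤x | m≤n⇒m<n∨m≡n a≤y
... | inj₂ refl | _ rewrite <ᵇ-false {a} ≤-refl | ≡ᵇ-refl a =
  ≤-trans (depth-path (suc m) a≤y) (≤-reflexive (sym (m≤n⇒∣m-n∣≡n∸m a≤y)))
... | inj₁ a<x | inj₂ refl
  rewrite <ᵇ-false a≤x | <ᵇ-true a<x | <ᵇ-false {a} ≤-refl | ≡ᵇ-refl a | ≡ᵇ-false (>⇒≢ a<x) = begin
    suc (depth (path (suc a) m) x) + 0  ≡⟨ +-identityʳ _ ⟩
    suc (depth (path (suc a) m) x)      ≤⟨ s≤s (depth-path m a<x) ⟩
    suc (x ∸ suc a)                     ≡⟨ +-∸-assoc 1 a<x ⟨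
    x ∸ a                               ≡⟨ m≤n⇒∣n-m∣≡n∸m a≤x ⟨
    ∣ x - a ∣                           ∎
  where open ≤-Reasoning
... | inj₁ a<x | inj₁ a<y rewrite <ᵇ-false a≤x | <ᵇ-true a<x | <ᵇ-true a<y = dist-path m a<x a<y

Contracting : BT → (ℕ → ℕ) → Set
Contracting T r = ∀ a b → dist T (r a) (r b) ≤ ∣ a - b ∣

m∸n∸[m∸o]≤o∸n : ∀ m {n o} → n ≤ o → m ∸ n ∸ (m ∸ o) ≤ o ∸ n
m∸n∸[m∸o]≤o∸n m (z≤n {o}) =
  m≤n+o⇒m∸n≤o m (m ∸ o) (subst (m ≤_) (+-comm o (m ∸ o)) (m≤n+m∸n m o))
m∸n∸[m∸o]≤o∸n zero (s≤s n≤o) = z≤n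
m∸n∸[m∸o]≤o∸n (suc m) (s≤s n≤o) = m∸n∸[m∸o]≤o∸n m n≤o

∣m∸n-m∸o∣≤∣n-o∣ : ∀ m n o → ∣ m ∸ n - m ∸ o ∣ ≤ ∣ n - o ∣
∣m∸n-m∸o∣≤∣n-o∣ m n o = [ ordered , swapped ]′ (≤-total n o)
  where
  open ≤-Reasoning
  ordered : ∀ {n o} → n ≤ o → ∣ m ∸ n - m ∸ o ∣ ≤ ∣ n - o ∣
  ordered {n} {o} n≤o = begin
    ∣ m ∸ n - m ∸ o ∣  ≡⟨ m≤n⇒∣n-m∣≡n∸m (∸-monoʳ-≤ m n≤o) ⟩
    m ∸ n ∸ (m ∸ o)    ≤⟨ m∸n∸[m∸o]≤o∸n m n≤o ⟩
    o ∸ n              ≡⟨ m≤n⇒∣m-n∣≡n∸m n≤o ⟨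
    ∣ n - o ∣          ∎
  swapped : o ≤ n → ∣ m ∸ n - m ∸ o ∣ ≤ ∣ n - o ∣
  swapped o≤n = subst₂ _≤_ (∣-∣-comm (m ∸ o) (m ∸ n)) (∣-∣-comm o n) (ordered o≤n)

path-contracting : ∀ n → Contracting (path 0 n) (λ a → a)
path-contracting n a b = dist-path n z≤n z≤n

path-contracting-reflected : ∀ n B → Contracting (path 0 n) (B ∸_)
path-contracting-reflected n B a b = ≤-trans (dist-path n z≤n z≤n) (∣m∸n-m∸o∣≤∣n-o∣ B a b)

-- Amortised cost of descending finger strategies

update-≡ : ∀ {k} (σ : Fin k → ℕ) f x → update σ f x f ≡ x
update-≡ σ f x with f ≟ f
... | yes _ = refl
... | no f≢f = contradiction refl f≢f

update-≢ : ∀ {k} (σ : Fin k → ℕ) f x i → i ≢ f → update σ f x i ≡ σ i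
update-≢ σ f x i i≢f with i ≟ f
... | yes i≡f = contradiction i≡f i≢f
... | no _ = refl

update-suc : ∀ {k} (σ : Fin (suc k) → ℕ) f x → update σ (suc f) x ∘ suc ≗ update (σ ∘ suc) f x
update-suc σ f x i with i ≟ f
... | yes _ = refl
... | no _ = refl

update-cong : ∀ {k} {σ τ : Fin k → ℕ} → σ ≗ τ → ∀ f x → update σ f x ≗ update τ f x
update-cong σ≗τ f x i with i ≟ f
... | yes _ = refl
... | no _ = σ≗τ i

update-∘ : ∀ {k} (r : ℕ → ℕ) (σ : Fin k → ℕ) f x → update (r ∘ σ) f (r x) ≗ r ∘ update σ f x
update-∘ r σ f x i with i ≟ f
... | yes _ = refl
... | no _ = refl

potential : ∀ {k} → (Fin k → ℕ) → ℕ
potential σ = foldr _+_ 0 σ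

potential-cong : ∀ {k} {σ τ : Fin k → ℕ} → σ ≗ τ → potential σ ≡ potential τ
potential-cong {zero} σ≗τ = refl
potential-cong {suc k} σ≗τ = cong₂ _+_ (σ≗τ zero) (potential-cong (σ≗τ ∘ suc))

potential-update : ∀ {k} (σ : Fin k → ℕ) f x → potential (update σ f x) + σ f ≡ potential σ + x
potential-update σ zero x = begin
  update σ zero x zero + potential (update σ zero x ∘ suc) + σ zero
    ≡⟨ cong₂ (λ a b → a + b + σ zero) (update-≡ σ zero x)
         (potential-cong (λ i → update-≢ σ zero x (suc i) λ ())) ⟩
  x + potential (σ ∘ suc) + σ zero
    ≡⟨ xy∙z≈zy∙x x (potential (σ ∘ suc)) (σ zero) ⟩
  σ zero + potential (σ ∘ suc) + x
    ∎
  where open ≡-Reasoning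
potential-update σ (suc f) x = begin
  update σ (suc f) x zero + potential (update σ (suc f) x ∘ suc) + σ (suc f)
    ≡⟨ cong₂ (λ a b → a + b + σ (suc f)) (update-≢ σ (suc f) x zero λ ())
         (potential-cong (update-suc σ f x)) ⟩
  σ zero + potential (update (σ ∘ suc) f x) + σ (suc f)
    ≡⟨ +-assoc (σ zero) _ _ ⟩
  σ zero + (potential (update (σ ∘ suc) f x) + σ (suc f))
    ≡⟨ cong (σ zero +_) (potential-update (σ ∘ suc) f x) ⟩
  σ zero + (potential (σ ∘ suc) + x)
    ≡⟨ +-assoc (σ zero) _ _ ⟨
  σ zero + potential (σ ∘ suc) + x
    ∎
  where open ≡-Reasoning

serveCost-cong : ∀ {k m} T {σ τ : Fin k → ℕ} → σ ≗ τ → (v : Vec (Fin k × ℕ) m) →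
                 serveCost T σ v ≡ serveCost T τ v
serveCost-cong T σ≗τ [] = refl
serveCost-cong T σ≗τ ((f , x) ∷ v) =
  cong₂ (λ d c → suc d + c) (cong (dist T x) (σ≗τ f)) (serveCost-cong T (update-cong σ≗τ f x) v)

Descending : ∀ {k m} → (Fin k → ℕ) → (Fin m → Fin k) → (Fin m → ℕ) → Set
Descending {m = zero} σ f s = ⊤
Descending {m = suc m} σ f s =
  s zero ≤ σ (f zero) × Descending (update σ (f zero) (s zero)) (f ∘ suc) (s ∘ suc)

n∸m+p≡o : ∀ {m n} o p → m ≤ n → p + n ≡ o + m → n ∸ m + p ≡ o
n∸m+p≡o {m} {n} o p m≤n eq = +-cancelʳ-≡ m _ _ (begin
  n ∸ m + p + m    ≡⟨ +-assoc (n ∸ m) p m ⟩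
  n ∸ m + (p + m)  ≡⟨ cong (n ∸ m +_) (+-comm p m) ⟩
  n ∸ m + (m + p)  ≡⟨ +-assoc (n ∸ m) m p ⟨
  n ∸ m + m + p    ≡⟨ cong (_+ p) (m∸n+n≡m m≤n) ⟩
  n + p            ≡⟨ +-comm n p ⟩
  p + n            ≡⟨ eq ⟩
  o + m            ∎)
  where open ≡-Reasoning

serveCost-descending : ∀ {k m T r} → Contracting T r →
  (σ : Fin k → ℕ) (f : Fin m → Fin k) (s : Fin m → ℕ) → Descending σ f s →
  serveCost T (r ∘ σ) (tabulate (λ t → f t , r (s t))) ≤ m + potential σ
serveCost-descending {m = zero} contr σ f s _ = z≤n
serveCost-descending {m = suc m} {T} {r} contr σ f s (x≤σp , desc) = begin
  suc (dist T (r x) (r (σ p))) + serveCost T (update (r ∘ σ) p (r x)) rest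
    ≡⟨ cong (suc (dist T (r x) (r (σ p))) +_) (serveCost-cong T (update-∘ r σ p x) rest) ⟩
  suc (dist T (r x) (r (σ p))) + serveCost T (r ∘ σ′) rest
    ≤⟨ +-mono-≤ (s≤s (contr x (σ p))) (serveCost-descending contr σ′ (f ∘ suc) (s ∘ suc) desc) ⟩
  suc ∣ x - σ p ∣ + (m + potential σ′)
    ≡⟨ cong (λ d → suc d + (m + potential σ′)) (m≤n⇒∣m-n∣≡n∸m x≤σp) ⟩
  suc (σ p ∸ x) + (m + potential σ′)
    ≡⟨ cong suc (x∙yz≈y∙xz (σ p ∸ x) m (potential σ′)) ⟩
  suc m + (σ p ∸ x + potential σ′)
    ≡⟨ cong (suc m +_) (n∸m+p≡o (potential σ) (potential σ′) x≤σp (potential-update σ p x)) ⟩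
  suc m + potential σ
    ∎
  where
  open ≤-Reasoning
  x = s zero
  p = f zero
  σ′ = update σ p x
  rest = tabulate (λ t → f (suc t) , r (s (suc t)))

-- Patience sorting

-- `Ascent s b j`: `s` has a strictly increasing subsequence of length `j` whose terms are all `≥ b`.
data Ascent : ∀ {m} → (Fin m → ℕ) → ℕ → ℕ → Set where
  []   : ∀ {m} {s : Fin m → ℕ} {b} → Ascent s b 0
  skip : ∀ {m} {s : Fin (suc m) → ℕ} {b j} → Ascent (s ∘ suc) b j → Ascent s b j
  take : ∀ {m} {s : Fin (suc m) → ℕ} {b j} →
         b ≤ s zero → Ascent (s ∘ suc) (suc (s zero)) j → Ascent s b (suc j)

Subsequence : ∀ {m} → (Fin m → ℕ) → ℕ → ℕ → Set
Subsequence {m} s b j = Σ (Fin j → Fin m) λ ι →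
  ι Preserves F._<_ ⟶ F._<_ × (s ∘ ι) Preserves F._<_ ⟶ _<_ × (∀ a → b ≤ s (ι a))

ascent⇒subsequence : ∀ {m} {s : Fin m → ℕ} {b j} → Ascent s b j → Subsequence s b j
ascent⇒subsequence [] = (λ ()) , (λ {}) , (λ {}) , (λ ())
ascent⇒subsequence (skip asc) with ascent⇒subsequence asc
... | ι , ι↑ , sι↑ , bounded = suc ∘ ι , s≤s ∘ ι↑ , sι↑ , bounded
ascent⇒subsequence {s = s} {b} (take b≤s₀ asc) with ascent⇒subsequence asc
... | ι , ι↑ , sι↑ , bounded = ι′ , ι′↑ , sι′↑ , bounded′
  where
  ι′ : Fin _ → Fin _
  ι′ zero = zero
  ι′ (suc a) = suc (ι a)
  ι′↑ : ι′ Preserves F._<_ ⟶ F._<_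
  ι′↑ {zero} {suc c} _ = s≤s z≤n
  ι′↑ {suc a} {suc c} (s≤s a<c) = s≤s (ι↑ a<c)
  sι′↑ : (s ∘ ι′) Preserves F._<_ ⟶ _<_
  sι′↑ {zero} {suc c} _ = bounded c
  sι′↑ {suc a} {suc c} (s≤s a<c) = sι↑ a<c
  bounded′ : ∀ a → b ≤ s (ι′ a)
  bounded′ zero = b≤s₀
  bounded′ (suc a) = ≤-trans b≤s₀ (<⇒≤ (bounded a))

strictMono-reflects : ∀ {j} {_≺_ : Rel ℕ 0ℓ} → Irreflexive _≡_ _≺_ → Asymmetric _≺_ →
  ∀ {g : Fin j → ℕ} → g Preserves F._<_ ⟶ _≺_ → ∀ {a b} → g a ≺ g b → a F.< b
strictMono-reflects irrefl asym g↑ {a} {b} ga≺gb with F.<-cmp a b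
... | tri< a<b _ _ = a<b
... | tri≈ _ refl _ = contradiction ga≺gb (irrefl refl)
... | tri> _ _ b<a = contradiction (g↑ b<a) (asym ga≺gb)

opposite-<⇔> : ∀ {j} {a b : Fin j} → opposite a F.< opposite b ⇔ b F.< a
opposite-<⇔> {j} {a} {b} = mk⇔ to from
  where
  to : opposite a F.< opposite b → b F.< a
  to oa<ob = ≰⇒> λ a≤b → <⇒≱ oa<ob
    (subst₂ _≤_ (sym (opposite-prop b)) (sym (opposite-prop a)) (∸-monoʳ-≤ j (s≤s a≤b)))
  from : b F.< a → opposite a F.< opposite b
  from b<a = subst₂ _<_ (sym (opposite-prop a)) (sym (opposite-prop b)) (∸-monoʳ-< (s≤s b<a) (toℕ<n a))

avoids-id⇒¬ascent : ∀ {m j b} {s : Fin m → ℕ} → Avoids s (idPerm j) → ¬ Ascent s b j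
avoids-id⇒¬ascent avoids asc with ascent⇒subsequence asc
... | ι , ι↑ , sι↑ , _ =
  avoids (ι , (λ _ _ → ι↑) , λ a b → mk⇔ (strictMono-reflects <-irrefl <-asym sι↑) sι↑)

avoids-rev⇒¬ascent : ∀ {m j b B} {s : Fin m → ℕ} → Avoids s (revPerm j) →
                     ¬ Ascent (λ t → B ∸ s t) b j
avoids-rev⇒¬ascent {B = B} {s} avoids asc with ascent⇒subsequence asc
... | ι , ι↑ , Bsι↑ , _ = avoids (ι , (λ _ _ → ι↑) , λ a b → mk⇔
    (Equivalence.from opposite-<⇔> ∘ strictMono-reflects (<-irrefl ∘ sym) <-asym sι↓)
    (sι↓ ∘ Equivalence.to opposite-<⇔>))
  where
  sι↓ : ∀ {a c} → a F.< c → s (ι c) < s (ι a)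
  sι↓ a<c = ≰⇒> λ sιa≤sιc → <⇒≱ (Bsι↑ a<c) (∸-monoʳ-≤ B sιa≤sιc)

firstFit : ∀ {k} → (Fin (suc k) → ℕ) → ℕ → Fin (suc k)
firstFit {zero} σ x = zero
firstFit {suc k} σ x with x ≤? σ zero
... | yes _ = zero
... | no _ = suc (firstFit (σ ∘ suc) x)

firstFit-minimal : ∀ {k} (σ : Fin (suc k) → ℕ) x {j} → j F.< firstFit σ x → σ j < x
firstFit-minimal {suc k} σ x {j} j<p with x ≤? σ zero
firstFit-minimal {suc k} σ x {zero} _ | no x≰σ₀ = ≰⇒> x≰σ₀
firstFit-minimal {suc k} σ x {suc j} (s≤s j<p) | no _ = firstFit-minimal (σ ∘ suc) x j<p

firstFit-fits : ∀ {k} (σ : Fin (suc k) → ℕ) x → x ≤ σ (fromℕ k) → x ≤ σ (firstFit σ x)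
firstFit-fits {zero} σ x x≤σₖ = x≤σₖ
firstFit-fits {suc k} σ x x≤σₖ with x ≤? σ zero
... | yes x≤σ₀ = x≤σ₀
... | no _ = firstFit-fits (σ ∘ suc) x x≤σₖ

greedy : ∀ {k m} → (Fin (suc k) → ℕ) → (Fin m → ℕ) → Fin m → Fin (suc k)
greedy σ s zero = firstFit σ (s zero)
greedy σ s (suc t) = greedy (update σ (firstFit σ (s zero)) (s zero)) (s ∘ suc) t

-- Finger i is either still parked at the ceiling B, or no ascent of length k - i lies
-- above it. For the last finger this forces σ k ≥ B, so some finger always fits.
Patience : ∀ {k m} → ℕ → (Fin (suc k) → ℕ) → (Fin m → ℕ) → Set
Patience {k} B σ s = ∀ i → B ≤ σ i ⊎ ¬ Ascent s (suc (σ i)) (k ∸ toℕ i)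

patience-fits : ∀ {k m B} (σ : Fin (suc k) → ℕ) (s : Fin m → ℕ) x → x ≤ B → Patience B σ s →
                x ≤ σ (firstFit σ x)
patience-fits {k} {B = B} σ s x x≤B patience with patience (fromℕ k)
... | inj₁ B≤σₖ = firstFit-fits σ x (≤-trans x≤B B≤σₖ)
... | inj₂ ¬asc = contradiction (subst (Ascent s _) k∸k≡0 []) ¬asc
  where k∸k≡0 = sym (trans (cong (k ∸_) (toℕ-fromℕ k)) (n∸n≡0 k))

patience-settle : ∀ {k m B} (σ : Fin (suc k) → ℕ) (s : Fin (suc m) → ℕ) (p : Fin (suc k)) →
  (∀ {j} → j F.< p → σ j < s zero) → s zero ≤ B → ¬ Ascent s 0 (suc k) → Patience B σ s →
  ¬ Ascent (s ∘ suc) (suc (s zero)) (k ∸ toℕ p)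
patience-settle σ s zero _ _ ¬asc _ asc = ¬asc (take z≤n asc)
patience-settle {k} σ s (suc j) below x≤B _ patience asc =
  [ (λ B≤σⱼ → <⇒≱ σⱼ<x (≤-trans x≤B B≤σⱼ))
  , (λ ¬ascⱼ → ¬ascⱼ (subst (Ascent s _) len (take σⱼ<x asc)))
  ]′ (patience (inject₁ j))
  where
  σⱼ<x = below (F.≤̄⇒inject₁< ≤-refl)
  len : suc (k ∸ suc (toℕ j)) ≡ k ∸ toℕ (inject₁ j)
  len = trans (sym (+-∸-assoc 1 (toℕ<n j))) (cong (k ∸_) (sym (toℕ-inject₁ j)))

patience-step : ∀ {k m B} (σ : Fin (suc k) → ℕ) (s : Fin (suc m) → ℕ) →
  s zero ≤ B → ¬ Ascent s 0 (suc k) → Patience B σ s →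
  Patience B (update σ (firstFit σ (s zero)) (s zero)) (s ∘ suc)
-- Abstracting over the same test that `update` performs makes `update` compute in each branch.
patience-step σ s x≤B ¬asc patience i with i ≟ firstFit σ (s zero)
... | yes refl = inj₂ (patience-settle σ s i (firstFit-minimal σ (s zero)) x≤B ¬asc patience)
... | no _ = map₂ (λ ¬ascᵢ → ¬ascᵢ ∘ skip) (patience i)

greedy-descending : ∀ {k m B} (σ : Fin (suc k) → ℕ) (s : Fin m → ℕ) →
  (∀ t → s t ≤ B) → ¬ Ascent s 0 (suc k) → Patience B σ s → Descending σ (greedy σ s) s
greedy-descending {m = zero} σ s _ _ _ = _
greedy-descending {m = suc m} σ s s≤B ¬asc patience =
  patience-fits σ s (s zero) (s≤B zero) patience ,
  greedy-descending _ (s ∘ suc) (s≤B ∘ suc) (¬asc ∘ skip) (patience-step σ s (s≤B zero) ¬asc patience)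

potential-const : ∀ k B → potential {k} (const B) ≡ k * B
potential-const zero B = refl
potential-const (suc k) B = cong (B +_) (potential-const k B)

greedy-LF-T-≤ : ∀ {n m k B T} (r : ℕ → ℕ) → Contracting T r →
  (S : Fin m → Fin n) (s : Fin m → ℕ) → (∀ t → toℕ (S t) ≡ r (s t)) → (∀ t → s t ≤ B) →
  ¬ Ascent s 0 (suc k) → (ℓ : Fin n) → toℕ ℓ ≡ r B →
  LF-T-≤ (suc k) T S (m + suc k * B)
greedy-LF-T-≤ {m = m} {k} {B} {T} r contr S s S≡rs s≤B ¬asc ℓ ℓ≡rB =
  greedy σ s , const ℓ , (begin
    serveCost T (const (toℕ ℓ)) (tabulate (λ t → greedy σ s t , toℕ (S t)))
      ≡⟨ serveCost-cong T (λ _ → ℓ≡rB) (tabulate (λ t → greedy σ s t , toℕ (S t))) ⟩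
    serveCost T (r ∘ σ) (tabulate (λ t → greedy σ s t , toℕ (S t)))
      ≡⟨ cong (serveCost T (r ∘ σ)) (tabulate-cong (λ t → cong (greedy σ s t ,_) (S≡rs t))) ⟩
    serveCost T (r ∘ σ) (tabulate (λ t → greedy σ s t , r (s t)))
      ≤⟨ serveCost-descending contr σ (greedy σ s) s
           (greedy-descending σ s s≤B ¬asc (λ _ → inj₁ ≤-refl)) ⟩
    m + potential σ
      ≡⟨ cong (m +_) (potential-const (suc k) B) ⟩
    m + suc k * B ∎)
  where
  open ≤-Reasoning
  σ : Fin (suc k) → ℕ
  σ = const B

LF-T-≤-mono : ∀ {n m k T} {S : Fin m → Fin n} {b b′} → b ≤ b′ → LF-T-≤ k T S b → LF-T-≤ k T S b′
LF-T-≤-mono b≤b′ (f , ℓ , cost≤b) = f , ℓ , ≤-trans cost≤b b≤b′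

1+n+[1+k]*n≤2*[1+n]*[1+k] : ∀ n k → suc n + suc k * n ≤ 2 * suc n * suc k
1+n+[1+k]*n≤2*[1+n]*[1+k] n k = begin
  suc n + suc k * n              ≤⟨ +-mono-≤ (m≤m*n (suc n) (suc k)) (*-monoʳ-≤ (suc k) (n≤1+n n)) ⟩
  suc n * suc k + suc k * suc n  ≡⟨ cong (suc n * suc k +_) (*-comm (suc k) (suc n)) ⟩
  suc n * suc k + suc n * suc k  ≡⟨ cong (suc n * suc k +_) (+-identityʳ _) ⟨
  2 * (suc n * suc k)            ≡⟨ *-assoc 2 (suc n) (suc k) ⟨
  2 * suc n * suc k              ∎
  where open ≤-Reasoning

greedy-path-LF-T-≤ : ∀ {n k} (S : Fin (suc n) → Fin (suc n)) → KMonotone (suc k) (toℕ ∘ S) →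
                     LF-T-≤ (suc k) (path 0 (suc n)) S (suc n + suc k * n)
greedy-path-LF-T-≤ {n} S (inj₁ avoidsInc) =
  greedy-LF-T-≤ (λ a → a) (path-contracting (suc n)) S (toℕ ∘ S)
    (λ _ → refl) (λ t → ≤-pred (toℕ<n (S t)))
    (avoids-id⇒¬ascent avoidsInc) (fromℕ n) (toℕ-fromℕ n)
greedy-path-LF-T-≤ {n} S (inj₂ avoidsDec) =
  greedy-LF-T-≤ (n ∸_) (path-contracting-reflected (suc n) n) S (λ t → n ∸ toℕ (S t))
    (λ t → sym (m∸[m∸n]≡n (≤-pred (toℕ<n (S t))))) (λ t → m∸n≤m n (toℕ (S t)))
    (avoids-rev⇒¬ascent {B = n} {toℕ ∘ S} avoidsDec) zero (sym (n∸n≡0 n))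

mainTheorem10 : Σ ℕ λ c → ∀ (n k : ℕ) → 1 ≤ n → 1 ≤ k →
                  (S : Fin n → Fin n) → KMonotone k (λ i → toℕ (S i)) →
                  LF-≤ k S (c * n * k)
mainTheorem10 = 2 , λ where
  (suc n) (suc k) _ _ S monotone →
    path 0 (suc n) , path-isBST (suc n) ,
    LF-T-≤-mono {S = S} (1+n+[1+k]*n≤2*[1+n]*[1+k] n k) (greedy-path-LF-T-≤ S monotone)
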